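{- Let $\{g_n\}_{n\ge1}$ be a sequence of real numbers, set $g_0=-1$, and let $\{x_n\}_{n\ge1}$ be the row sums of the general PI tree built from $\{g_n\}$, with $x_0=1$. Then for every $n\ge1$: \[ x_n=\sum_{\pi\in\mathcal{C}(n)} g_\pi=\sum_{p=1}^{n}\sum_{\substack{k_1+\dots+k_p=n\\ k_i\ge1}} g_{k_1}\cdots g_{k_p}, \qquad x_n=\sum_{p=1}^{n}\binom{n+1}{p+1}\sum_{\substack{k_1+\dots+k_p=n\\ k_i\ge0}} g_{k_1}\cdots g_{k_p}. \] Conversely, for every $n\ge1$, \[ g_n=\sum_{\pi\in\mathcal{C}(n)}(-1)^{|\pi|+1}x_\pi=\sum_{p=1}^{n}(-1)^{p+1}\sum_{\substack{k_1+\dots+k_p=n\\ k_i\ge1}} x_{k_1}\cdots x_{k_p}, \qquad g_n=\sum_{p=1}^{n}(-1)^{p+1}\binom{n+1}{p+1}\sum_{\substack{k_1+\dots+k_p=n\\ k_i\ge0}} x_{k_1}\cdots x_{k_p}. \]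
   Context: General PI tree (Fuchs): given an input sequence $\{g_n\}_{n\ge1}$, build a binary tree whose nodes are words $g_{i_1}g_{i_2}\cdots g_{i_k}$ in the (noncommuting, during construction) symbols $g_i$. The root (row 1) is $g_1$. Each node $g_{i_1}g_{i_2}\cdots g_{i_k}$ has two children: $g_1g_{i_1}g_{i_2}\cdots g_{i_k}$ (operator $P$, "put a 1") and $g_{i_1+1}g_{i_2}\cdots g_{i_k}$ (operator $I$, "increase"). Row $n$ thus contains $2^{n-1}$ words; the row sum $x_n$ is the sum over the words of row $n$ of the corresponding products of the real numbers $g_i$. A composition of $n\ge1$ is a sequence $\pi=(n_1,\dots,n_m)$ of integers $n_i\ge1$ summing to $n$; $\mathcal{C}(n)$ is the set of compositions of $n$, $|\pi|=m$, and $g_\pi=g_{n_1}\cdots g_{n_m}$ (similarly $x_\pi$). -}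

module Defs where

open import Level using (Level)
open import Data.Nat using (ℕ; zero; suc; _∸_)
open import Data.Nat.Combinatorics using (_C_)
open import Data.List using (List; []; _∷_; [_]; map; concatMap; applyUpTo)
open import Algebra.Bundles using (CommutativeRing)

-- Words of the PI tree: lists of indices i₁ ∷ i₂ ∷ … ∷ iₖ standing for g_{i₁} g_{i₂} ⋯ g_{iₖ}.
Word : Set
Word = List ℕ

-- The two children of a word: P (put a 1 in front) and I (increase the first index).
children : Word → List Word
children []       = []   -- never occurs (words are nonempty)
children (i ∷ w)  = (1 ∷ i ∷ w) ∷ (suc i ∷ w) ∷ []

-- treeRow m = row (m+1) of the PI tree; row 1 is the root g₁.
treeRow : ℕ → List Word
treeRow zero    = [ 1 ∷ [] ]
treeRow (suc m) = concatMap children (treeRow m)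

oneTo : ℕ → List ℕ
oneTo = applyUpTo suc

zeroTo : ℕ → List ℕ
zeroTo n = applyUpTo (λ k → k) (suc n)

compsAux : ℕ → ℕ → List (List ℕ)
compsAux _        zero    = [] ∷ []
compsAux zero     (suc n) = []
compsAux (suc f)  n       = concatMap (λ k → map (k ∷_) (compsAux f (n ∸ k))) (oneTo n)

𝒞 : ℕ → List (List ℕ)
𝒞 n = compsAux n n

posTuples : ℕ → ℕ → List (List ℕ)
posTuples zero    zero    = [] ∷ []
posTuples zero    (suc n) = []
posTuples (suc p) n       = concatMap (λ k → map (k ∷_) (posTuples p (n ∸ k))) (oneTo n)

natTuples : ℕ → ℕ → List (List ℕ)
natTuples zero    zero    = [] ∷ []
natTuples zero    (suc n) = []
natTuples (suc p) n       = concatMap (λ k → map (k ∷_) (natTuples p (n ∸ k))) (zeroTo n)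

module PI {c ℓ : Level} (R : CommutativeRing c ℓ) where
  open CommutativeRing R

  Σ : List Carrier → Carrier
  Σ []       = 0#
  Σ (a ∷ as) = a + Σ as

  Π : List Carrier → Carrier
  Π []       = 1#
  Π (a ∷ as) = a * Π as

  prodOf : (ℕ → Carrier) → List ℕ → Carrier
  prodOf f π = Π (map f π)

  fromℕ : ℕ → Carrier
  fromℕ zero    = 0#
  fromℕ (suc n) = 1# + fromℕ n

  sgn : ℕ → Carrier
  sgn zero    = 1#
  sgn (suc p) = - 1# * sgn p

  len : List ℕ → ℕ
  len []      = 0
  len (_ ∷ π) = suc (len π)

  x : (ℕ → Carrier) → ℕ → Carrier
  x g zero    = 1#
  x g (suc m) = Σ (map (prodOf g) (treeRow m))

-- Weighting the first letter of every word of the PI tree by an arbitrary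
-- φ, the moves P and I replace φ by φ₁·g + φ∘suc; unwinding this gives
-- x_{m+1} = Σ_{i≤m} g_{i+1} x_{m−i}, the recursion satisfied by the sum of
-- g_π over compositions (split off the first part), so x_n = Σ_{π∈𝒞(n)} g_π.
-- Grouping compositions by their number of parts gives the second formula.
-- If g₀ = −1, a zero part contributes −1, so that, writing N_p(n) for the
-- sum over p-tuples with parts ≥ 0, Σ_{k≥1} g_k N_p(n−k) = N_{p+1}(n) + N_p(n);
-- with Pascal's rule the sum over p-tuples with parts ≥ 1 becomes
-- Σ_q C(p,q) N_q(n), and summing over p ≤ n with the hockey-stick identity
-- produces C(n+1,q+1).  Conversely, the recursion for x says (x₀ = 1, g₀ = −1)
-- that −g is the convolution inverse of x, so the sum over compositions of
-- −x is −g; the converse formulas follow by extracting signs.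
module Submission where

open import Defs
open import Level using (Level)
open import Data.Nat using (ℕ; zero; suc; _∸_; _≤_; _<_; s≤s)
import Data.Nat as ℕ
open import Data.Nat.Properties using (≤-refl; ≤-trans; ≤-pred; m≤n⇒m≤1+n; m∸n≤m; +-∸-assoc; m∸[m∸n]≡n; n∸n≡0)
open import Data.Nat.Combinatorics using (_C_; k>n⇒nCk≡0; nCk+nC[k+1]≡[n+1]C[k+1])
open import Data.Nat.Induction using (<-rec)
open import Data.Fin using (toℕ)
open import Data.Fin.Properties using (toℕ<n; toℕ-inject₁; toℕ-fromℕ; opposite-prop)
import Data.Fin.Permutation as Permutation
open import Data.List using (List; []; _∷_; _++_; map; concatMap; applyUpTo)
open import Data.List.Properties using (map-++)
open import Data.Product using (_×_; _,_)
import Relation.Binary.PropositionalEquality as ≡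
open import Algebra.Bundles using (CommutativeRing)
import Algebra.Properties.Ring as RingProperties
import Algebra.Properties.Group as GroupProperties
import Algebra.Properties.CommutativeSemigroup as CommutativeSemigroupProperties
import Algebra.Properties.Semiring.Sum as SemiringSum

module _ {c ℓ : Level} (R : CommutativeRing c ℓ) where
  open CommutativeRing R
  open PI R
  open RingProperties ring using (-1*x≈-x; -‿distribˡ-*; -‿distribʳ-*; -‿involutive; -‿+-comm; -0#≈0#)
  open GroupProperties +-group using (inverseʳ-unique)
  open CommutativeSemigroupProperties *-commutativeSemigroup using (x∙yz≈y∙xz; interchange)
  module + = CommutativeSemigroupProperties +-commutativeSemigroup
  open SemiringSum semiring
    using (sum; sum-cong-≋; sum-cong-≗; sum-replicate-zero; sum-init-last;
           ∑-distrib-+; ∑-comm; ∑-permute; *-distribˡ-sum; *-distribʳ-sum)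
  open import Relation.Binary.Reasoning.Setoid setoid

  -- ℕ-indexed sums, opaque so that unification does not unfold sums of length suc n.
  infix 10 ∑ℕ
  opaque
    ∑ℕ : ℕ → (ℕ → Carrier) → Carrier
    ∑ℕ n f = sum {n} (λ i → f (toℕ i))

  syntax ∑ℕ n (λ i → x) = ∑[ i < n ] x

  opaque
    unfolding ∑ℕ

    ∑-zero : (f : ℕ → Carrier) → ∑[ i < 0 ] f i ≈ 0#
    ∑-zero f = refl

    ∑-suc : ∀ n (f : ℕ → Carrier) → ∑[ i < suc n ] f i ≈ f 0 + ∑[ i < n ] f (suc i)
    ∑-suc n f = refl

    ∑-cong : ∀ n {f g : ℕ → Carrier} → (∀ i → i < n → f i ≈ g i) → ∑[ i < n ] f i ≈ ∑[ i < n ] g i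
    ∑-cong n f≈g = sum-cong-≋ {n} (λ i → f≈g (toℕ i) (toℕ<n i))

    ∑-≈0 : ∀ n {f : ℕ → Carrier} → (∀ i → f i ≈ 0#) → ∑[ i < n ] f i ≈ 0#
    ∑-≈0 n f≈0 = trans (sum-cong-≋ {n} (λ i → f≈0 (toℕ i))) (sum-replicate-zero n)

    ∑-last : ∀ n (f : ℕ → Carrier) → ∑[ i < suc n ] f i ≈ ∑[ i < n ] f i + f n
    ∑-last n f = trans (sum-init-last {n} (λ i → f (toℕ i)))
      (+-cong (reflexive (sum-cong-≗ {n} (λ i → ≡.cong f (toℕ-inject₁ i))))
              (reflexive (≡.cong f (toℕ-fromℕ n))))

    ∑-reverse : ∀ n (f : ℕ → Carrier) → ∑[ i < n ] f i ≈ ∑[ i < n ] f (n ∸ suc i)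
    ∑-reverse n f = trans (∑-permute {n} (λ i → f (toℕ i)) Permutation.reverse)
      (reflexive (sum-cong-≗ {n} (λ i → ≡.cong f (opposite-prop i))))

    ∑-+ : ∀ n (f g : ℕ → Carrier) → ∑[ i < n ] (f i + g i) ≈ ∑[ i < n ] f i + ∑[ i < n ] g i
    ∑-+ n f g = ∑-distrib-+ {n} (λ i → f (toℕ i)) (λ i → g (toℕ i))

    ∑-swap : ∀ m n (f : ℕ → ℕ → Carrier) → ∑[ i < m ] ∑[ j < n ] f i j ≈ ∑[ j < n ] ∑[ i < m ] f i j
    ∑-swap m n f = ∑-comm {m} {n} (λ i j → f (toℕ i) (toℕ j))

    *-distribˡ-∑ : ∀ n a (f : ℕ → Carrier) → a * ∑[ i < n ] f i ≈ ∑[ i < n ] (a * f i)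
    *-distribˡ-∑ n a f = *-distribˡ-sum {n} a (λ i → f (toℕ i))

    *-distribʳ-∑ : ∀ n a (f : ℕ → Carrier) → ∑[ i < n ] f i * a ≈ ∑[ i < n ] (f i * a)
    *-distribʳ-∑ n a f = *-distribʳ-sum {n} a (λ i → f (toℕ i))

    Σ-map-applyUpTo : ∀ (h : ℕ → Carrier) (f : ℕ → ℕ) n → Σ (map h (applyUpTo f n)) ≈ ∑[ i < n ] h (f i)
    Σ-map-applyUpTo h f zero    = refl
    Σ-map-applyUpTo h f (suc n) = +-congˡ (Σ-map-applyUpTo h (λ i → f (suc i)) n)

  fromℕ-+ : ∀ m n → fromℕ (m ℕ.+ n) ≈ fromℕ m + fromℕ n
  fromℕ-+ zero    n = sym (+-identityˡ _)
  fromℕ-+ (suc m) n = trans (+-congˡ (fromℕ-+ m n)) (sym (+-assoc _ _ _))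

  fromℕ-pascal : ∀ m p → fromℕ (suc m C suc p) ≈ fromℕ (m C p) + fromℕ (m C suc p)
  fromℕ-pascal m p = trans (reflexive (≡.cong fromℕ (≡.sym (nCk+nC[k+1]≡[n+1]C[k+1] m p))))
                           (fromℕ-+ (m C p) (m C suc p))

  ∑-hockey-stick : ∀ n p → ∑[ m < n ] fromℕ (m C p) ≈ fromℕ (n C suc p)
  ∑-hockey-stick zero    p = ∑-zero _
  ∑-hockey-stick (suc n) p = begin
    ∑[ m < suc n ] fromℕ (m C p)               ≈⟨ ∑-last n (λ m → fromℕ (m C p)) ⟩
    ∑[ m < n ] fromℕ (m C p) + fromℕ (n C p)   ≈⟨ +-congʳ (∑-hockey-stick n p) ⟩
    fromℕ (n C suc p) + fromℕ (n C p)          ≈⟨ +-comm _ _ ⟩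
    fromℕ (n C p) + fromℕ (n C suc p)          ≈⟨ fromℕ-pascal n p ⟨
    fromℕ (suc n C suc p)                      ∎

  -- Pascal's rule summed against a sequence a; m C 0 and suc m C 0 both compute to 1.
  ∑-pascal : ∀ {m D} → m ≤ D → (a : ℕ → Carrier) →
    ∑[ p < suc (suc D) ] (fromℕ (m C p) * (a (suc p) + a p))
      ≈ ∑[ p < suc (suc D) ] (fromℕ (suc m C p) * a p)
  ∑-pascal {m} {D} m≤D a = begin
    ∑[ p < suc (suc D) ] (b p * (a (suc p) + a p))
      ≈⟨ ∑-cong (suc (suc D)) (λ p _ → distribˡ (b p) _ _) ⟩
    ∑[ p < suc (suc D) ] (b p * a (suc p) + b p * a p)
      ≈⟨ ∑-+ (suc (suc D)) (λ p → b p * a (suc p)) (λ p → b p * a p) ⟩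
    ∑[ p < suc (suc D) ] (b p * a (suc p)) + ∑[ p < suc (suc D) ] (b p * a p)
      ≈⟨ +-cong (trans (∑-last (suc D) (λ p → b p * a (suc p))) dropLast) (∑-suc (suc D) (λ p → b p * a p)) ⟩
    A + (b 0 * a 0 + B)
      ≈⟨ +.x∙yz≈y∙xz _ _ _ ⟩
    b 0 * a 0 + (A + B)
      ≈⟨ +-congˡ (∑-+ (suc D) (λ p → b p * a (suc p)) (λ p → b (suc p) * a (suc p))) ⟨
    b 0 * a 0 + ∑[ p < suc D ] (b p * a (suc p) + b (suc p) * a (suc p))
      ≈⟨ +-congˡ (∑-cong (suc D) (λ p _ → trans (*-congʳ (fromℕ-pascal m p)) (distribʳ _ _ _))) ⟨
    fromℕ (suc m C 0) * a 0 + ∑[ p < suc D ] (fromℕ (suc m C suc p) * a (suc p))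
      ≈⟨ ∑-suc (suc D) (λ p → fromℕ (suc m C p) * a p) ⟨
    ∑[ p < suc (suc D) ] (fromℕ (suc m C p) * a p) ∎
    where
    b : ℕ → Carrier
    b p = fromℕ (m C p)
    A B : Carrier
    A = ∑[ p < suc D ] (b p * a (suc p))
    B = ∑[ p < suc D ] (b (suc p) * a (suc p))
    dropLast : A + b (suc D) * a (suc (suc D)) ≈ A
    dropLast = trans (+-congˡ (trans (*-congʳ (reflexive (≡.cong fromℕ (k>n⇒nCk≡0 (s≤s m≤D))))) (zeroˡ _)))
                     (+-identityʳ A)

  Σ-++ : ∀ (as bs : List Carrier) → Σ (as ++ bs) ≈ Σ as + Σ bs
  Σ-++ []       bs = sym (+-identityˡ _)
  Σ-++ (a ∷ as) bs = trans (+-congˡ (Σ-++ as bs)) (sym (+-assoc _ _ _))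

  Σ-map-concatMap : ∀ {A B : Set} (h : B → Carrier) (F : A → List B) (l : List A) →
    Σ (map h (concatMap F l)) ≈ Σ (map (λ a → Σ (map h (F a))) l)
  Σ-map-concatMap h F []      = refl
  Σ-map-concatMap h F (a ∷ l) = begin
    Σ (map h (F a ++ concatMap F l))
      ≡⟨ ≡.cong Σ (map-++ h (F a) (concatMap F l)) ⟩
    Σ (map h (F a) ++ map h (concatMap F l))
      ≈⟨ Σ-++ (map h (F a)) _ ⟩
    Σ (map h (F a)) + Σ (map h (concatMap F l))
      ≈⟨ +-congˡ (Σ-map-concatMap h F l) ⟩
    Σ (map h (F a)) + Σ (map (λ a → Σ (map h (F a))) l) ∎

  Σ-map-cong : ∀ {A : Set} {h h′ : A → Carrier} → (∀ a → h a ≈ h′ a) → ∀ l → Σ (map h l) ≈ Σ (map h′ l)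
  Σ-map-cong h≈h′ []      = refl
  Σ-map-cong h≈h′ (a ∷ l) = +-cong (h≈h′ a) (Σ-map-cong h≈h′ l)

  -‿Σ-map : ∀ {A : Set} {h h′ : A → Carrier} → (∀ a → - h a ≈ h′ a) → ∀ l → - Σ (map h l) ≈ Σ (map h′ l)
  -‿Σ-map -h≈h′ []      = -0#≈0#
  -‿Σ-map -h≈h′ (a ∷ l) = trans (sym (-‿+-comm _ _)) (+-cong (-h≈h′ a) (-‿Σ-map -h≈h′ l))

  Σ-prodOf-firstPart : ∀ f (T : ℕ → List (List ℕ)) (ks : List ℕ) →
    Σ (map (prodOf f) (concatMap (λ k → map (k ∷_) (T k)) ks)) ≈ Σ (map (λ k → f k * Σ (map (prodOf f) (T k))) ks)
  Σ-prodOf-firstPart f T ks = trans (Σ-map-concatMap (prodOf f) (λ k → map (k ∷_) (T k)) ks)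
                                    (Σ-map-cong (λ k → Σ-prodOf-cons k (T k)) ks)
    where
    Σ-prodOf-cons : ∀ k (L : List (List ℕ)) → Σ (map (prodOf f) (map (k ∷_) L)) ≈ f k * Σ (map (prodOf f) L)
    Σ-prodOf-cons k []      = sym (zeroʳ _)
    Σ-prodOf-cons k (π ∷ L) = trans (+-congˡ (Σ-prodOf-cons k L)) (sym (distribˡ _ _ _))

  Σpos Σnat Σcomps : (ℕ → Carrier) → ℕ → ℕ → Carrier
  Σpos f p n = Σ (map (prodOf f) (posTuples p n))
  Σnat f p n = Σ (map (prodOf f) (natTuples p n))
  Σcomps f fuel n = Σ (map (prodOf f) (compsAux fuel n))

  Σ𝒞 : (ℕ → Carrier) → ℕ → Carrier
  Σ𝒞 f n = Σ (map (prodOf f) (𝒞 n))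

  Σpos-suc : ∀ f p n → Σpos f (suc p) n ≈ ∑[ i < n ] (f (suc i) * Σpos f p (n ∸ suc i))
  Σpos-suc f p n = trans (Σ-prodOf-firstPart f (λ k → posTuples p (n ∸ k)) (oneTo n))
                         (Σ-map-applyUpTo (λ k → f k * Σpos f p (n ∸ k)) suc n)

  Σnat-suc : ∀ f p n → Σnat f (suc p) n ≈ ∑[ i < suc n ] (f i * Σnat f p (n ∸ i))
  Σnat-suc f p n = trans (Σ-prodOf-firstPart f (λ k → natTuples p (n ∸ k)) (zeroTo n))
                         (Σ-map-applyUpTo (λ k → f k * Σnat f p (n ∸ k)) (λ k → k) (suc n))

  Σcomps-suc : ∀ f fuel m → Σcomps f (suc fuel) (suc m) ≈ ∑[ i < suc m ] (f (suc i) * Σcomps f fuel (m ∸ i))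
  Σcomps-suc f fuel m = trans (Σ-prodOf-firstPart f (λ k → compsAux fuel (suc m ∸ k)) (oneTo (suc m)))
                              (Σ-map-applyUpTo (λ k → f k * Σcomps f fuel (suc m ∸ k)) suc (suc m))

  -- compsAux fuel n lists the compositions of n with at most fuel parts.
  Σcomps≈∑Σpos : ∀ f fuel n → Σcomps f fuel n ≈ ∑[ p < suc fuel ] Σpos f p n
  Σcomps≈∑Σpos f fuel zero = sym (trans (∑-suc fuel (λ p → Σpos f p 0))
                                        (trans (+-congˡ (∑-≈0 fuel (λ _ → refl))) (+-identityʳ _)))
  Σcomps≈∑Σpos f zero (suc m) = sym (trans (∑-suc 0 (λ p → Σpos f p (suc m)))
                                           (trans (+-congˡ (∑-zero _)) (+-identityʳ _)))
  Σcomps≈∑Σpos f (suc fuel) (suc m) = begin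
    Σcomps f (suc fuel) (suc m)
      ≈⟨ Σcomps-suc f fuel m ⟩
    ∑[ i < suc m ] (f (suc i) * Σcomps f fuel (m ∸ i))
      ≈⟨ ∑-cong (suc m) (λ i _ → *-congˡ (Σcomps≈∑Σpos f fuel (m ∸ i))) ⟩
    ∑[ i < suc m ] (f (suc i) * ∑[ p < suc fuel ] Σpos f p (m ∸ i))
      ≈⟨ ∑-cong (suc m) (λ i _ → *-distribˡ-∑ (suc fuel) (f (suc i)) _) ⟩
    ∑[ i < suc m ] ∑[ p < suc fuel ] (f (suc i) * Σpos f p (m ∸ i))
      ≈⟨ ∑-swap (suc m) (suc fuel) _ ⟩
    ∑[ p < suc fuel ] ∑[ i < suc m ] (f (suc i) * Σpos f p (m ∸ i))
      ≈⟨ ∑-cong (suc fuel) (λ p _ → Σpos-suc f p (suc m)) ⟨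
    ∑[ p < suc fuel ] Σpos f (suc p) (suc m)
      ≈⟨ +-identityˡ _ ⟨
    Σpos f 0 (suc m) + ∑[ p < suc fuel ] Σpos f (suc p) (suc m)
      ≈⟨ ∑-suc (suc fuel) (λ p → Σpos f p (suc m)) ⟨
    ∑[ p < suc (suc fuel) ] Σpos f p (suc m) ∎

  Σcomps-fuel : ∀ f {fuel fuel′ n} → n ≤ fuel → n ≤ fuel′ → Σcomps f fuel n ≈ Σcomps f fuel′ n
  Σcomps-fuel f {n = zero} _ _ = refl
  Σcomps-fuel f {suc fuel} {suc fuel′} {suc m} (s≤s m≤fuel) (s≤s m≤fuel′) = begin
    Σcomps f (suc fuel) (suc m)
      ≈⟨ Σcomps-suc f fuel m ⟩
    ∑[ i < suc m ] (f (suc i) * Σcomps f fuel (m ∸ i))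
      ≈⟨ ∑-cong (suc m) (λ i _ → *-congˡ (Σcomps-fuel f (≤-trans (m∸n≤m m i) m≤fuel) (≤-trans (m∸n≤m m i) m≤fuel′))) ⟩
    ∑[ i < suc m ] (f (suc i) * Σcomps f fuel′ (m ∸ i))
      ≈⟨ Σcomps-suc f fuel′ m ⟨
    Σcomps f (suc fuel′) (suc m) ∎

  Σ𝒞-suc : ∀ f m → Σ𝒞 f (suc m) ≈ ∑[ i < suc m ] (f (suc i) * Σ𝒞 f (m ∸ i))
  Σ𝒞-suc f m = trans (Σcomps-suc f m m) (∑-cong (suc m) (λ i _ → *-congˡ (Σcomps-fuel f (m∸n≤m m i) ≤-refl)))

  Σ𝒞≈∑Σpos : ∀ f n → Σ𝒞 f n ≈ ∑[ p < suc n ] Σpos f p n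
  Σ𝒞≈∑Σpos f n = Σcomps≈∑Σpos f n n

  -- The [] clause is junk: words of the tree are never empty.
  weight : (ℕ → Carrier) → (ℕ → Carrier) → Word → Carrier
  weight f φ []      = 0#
  weight f φ (i ∷ w) = φ i * prodOf f w

  Σweight-children : ∀ f φ w → Σ (map (weight f φ) (children w)) ≈ weight f (λ i → φ 1 * f i + φ (suc i)) w
  Σweight-children f φ []      = refl
  Σweight-children f φ (i ∷ w) = begin
    φ 1 * (f i * prodOf f w) + (φ (suc i) * prodOf f w + 0#)   ≈⟨ +-cong (sym (*-assoc _ _ _)) (+-identityʳ _) ⟩
    φ 1 * f i * prodOf f w + φ (suc i) * prodOf f w            ≈⟨ distribʳ _ _ _ ⟨
    (φ 1 * f i + φ (suc i)) * prodOf f w                       ∎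

  Σweight-treeRow : ∀ f φ m → Σ (map (weight f φ) (treeRow m)) ≈ ∑[ i < suc m ] (φ (suc i) * Σ𝒞 f (m ∸ i))
  Σweight-treeRow f φ zero = begin
    φ 1 * 1# + 0#
      ≈⟨ +-congʳ (*-congˡ (+-identityʳ 1#)) ⟨
    φ 1 * Σ𝒞 f 0 + 0#
      ≈⟨ +-congˡ (∑-zero _) ⟨
    φ 1 * Σ𝒞 f 0 + ∑[ i < 0 ] (φ (suc (suc i)) * Σ𝒞 f (0 ∸ suc i))
      ≈⟨ ∑-suc 0 (λ i → φ (suc i) * Σ𝒞 f (0 ∸ i)) ⟨
    ∑[ i < 1 ] (φ (suc i) * Σ𝒞 f (0 ∸ i)) ∎
  Σweight-treeRow f φ (suc m) = begin
    Σ (map (weight f φ) (concatMap children (treeRow m)))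
      ≈⟨ Σ-map-concatMap (weight f φ) children (treeRow m) ⟩
    Σ (map (λ w → Σ (map (weight f φ) (children w))) (treeRow m))
      ≈⟨ Σ-map-cong (Σweight-children f φ) (treeRow m) ⟩
    Σ (map (weight f φ′) (treeRow m))
      ≈⟨ Σweight-treeRow f φ′ m ⟩
    ∑[ i < suc m ] ((φ 1 * f (suc i) + φ (suc (suc i))) * Σ𝒞 f (m ∸ i))
      ≈⟨ ∑-cong (suc m) (λ i _ → trans (distribʳ _ _ _) (+-congʳ (*-assoc _ _ _))) ⟩
    ∑[ i < suc m ] (φ 1 * (f (suc i) * Σ𝒞 f (m ∸ i)) + φ (suc (suc i)) * Σ𝒞 f (m ∸ i))
      ≈⟨ ∑-+ (suc m) _ _ ⟩
    ∑[ i < suc m ] (φ 1 * (f (suc i) * Σ𝒞 f (m ∸ i))) + ∑[ i < suc m ] (φ (suc (suc i)) * Σ𝒞 f (m ∸ i))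
      ≈⟨ +-congʳ (trans (sym (*-distribˡ-∑ (suc m) (φ 1) _)) (*-congˡ (sym (Σ𝒞-suc f m)))) ⟩
    φ 1 * Σ𝒞 f (suc m) + ∑[ i < suc m ] (φ (suc (suc i)) * Σ𝒞 f (m ∸ i))
      ≈⟨ ∑-suc (suc m) (λ i → φ (suc i) * Σ𝒞 f (suc m ∸ i)) ⟨
    ∑[ i < suc (suc m) ] (φ (suc i) * Σ𝒞 f (suc m ∸ i)) ∎
    where
    φ′ : ℕ → Carrier
    φ′ i = φ 1 * f i + φ (suc i)

  Σ-prodOf≈Σweight : ∀ f m → Σ (map (prodOf f) (treeRow m)) ≈ Σ (map (weight f f) (treeRow m))
  Σ-prodOf≈Σweight f zero    = refl
  Σ-prodOf≈Σweight f (suc m) = begin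
    Σ (map (prodOf f) (concatMap children (treeRow m)))              ≈⟨ Σ-map-concatMap (prodOf f) children (treeRow m) ⟩
    Σ (map (λ w → Σ (map (prodOf f) (children w))) (treeRow m))      ≈⟨ Σ-map-cong childrenAgree (treeRow m) ⟩
    Σ (map (λ w → Σ (map (weight f f) (children w))) (treeRow m))    ≈⟨ Σ-map-concatMap (weight f f) children (treeRow m) ⟨
    Σ (map (weight f f) (concatMap children (treeRow m)))            ∎
    where
    childrenAgree : ∀ w → Σ (map (prodOf f) (children w)) ≈ Σ (map (weight f f) (children w))
    childrenAgree []      = refl
    childrenAgree (i ∷ w) = refl

  x≈Σ𝒞 : ∀ g n → x g n ≈ Σ𝒞 g n
  x≈Σ𝒞 g zero    = sym (+-identityʳ 1#)
  x≈Σ𝒞 g (suc m) = begin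
    Σ (map (prodOf g) (treeRow m))                ≈⟨ Σ-prodOf≈Σweight g m ⟩
    Σ (map (weight g g) (treeRow m))              ≈⟨ Σweight-treeRow g g m ⟩
    ∑[ i < suc m ] (g (suc i) * Σ𝒞 g (m ∸ i))    ≈⟨ Σ𝒞-suc g m ⟨
    Σ𝒞 g (suc m)                                  ∎

  Σ𝒞≈Σ-posTuples : ∀ f n → Σ𝒞 f (suc n) ≈ Σ (map (λ p → Σpos f p (suc n)) (oneTo (suc n)))
  Σ𝒞≈Σ-posTuples f n = begin
    Σ𝒞 f (suc n)                                                   ≈⟨ Σ𝒞≈∑Σpos f (suc n) ⟩
    ∑[ p < suc (suc n) ] Σpos f p (suc n)                          ≈⟨ ∑-suc (suc n) (λ p → Σpos f p (suc n)) ⟩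
    0# + ∑[ p < suc n ] Σpos f (suc p) (suc n)                     ≈⟨ +-identityˡ _ ⟩
    ∑[ p < suc n ] Σpos f (suc p) (suc n)                          ≈⟨ Σ-map-applyUpTo (λ p → Σpos f p (suc n)) suc (suc n) ⟨
    Σ (map (λ p → Σpos f p (suc n)) (oneTo (suc n)))               ∎

  module _ (h : ℕ → Carrier) (h₀≈-1 : h 0 ≈ - 1#) where

    -- The k = 0 term of Σnat h (suc p) n is h 0 · Σnat h p n = − Σnat h p n.
    ∑-Σnat-positiveFirst : ∀ p n →
      ∑[ i < n ] (h (suc i) * Σnat h p (n ∸ suc i)) ≈ Σnat h (suc p) n + Σnat h p n
    ∑-Σnat-positiveFirst p n = sym (begin
      Σnat h (suc p) n + N          ≈⟨ +-congʳ (trans (Σnat-suc h p n) (∑-suc n (λ i → h i * Σnat h p (n ∸ i)))) ⟩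
      (h 0 * N + S) + N             ≈⟨ +-congʳ (+-congʳ (trans (*-congʳ h₀≈-1) (-1*x≈-x N))) ⟩
      (- N + S) + N                 ≈⟨ +-congʳ (+-comm _ _) ⟩
      (S + - N) + N                 ≈⟨ +-assoc _ _ _ ⟩
      S + (- N + N)                 ≈⟨ +-congˡ (-‿inverseˡ N) ⟩
      S + 0#                        ≈⟨ +-identityʳ S ⟩
      S                             ∎)
      where
      N S : Carrier
      N = Σnat h p n
      S = ∑[ i < n ] (h (suc i) * Σnat h p (n ∸ suc i))

    Σpos≈∑binomial*Σnat : ∀ {m D} → m ≤ D → ∀ n → Σpos h m n ≈ ∑[ p < suc D ] (fromℕ (m C p) * Σnat h p n)
    Σpos≈∑binomial*Σnat {zero} {D} _ n = sym (begin
      ∑[ p < suc D ] (fromℕ (0 C p) * Σnat h p n)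
        ≈⟨ ∑-suc D (λ p → fromℕ (0 C p) * Σnat h p n) ⟩
      (1# + 0#) * Σnat h 0 n + ∑[ p < D ] (0# * Σnat h (suc p) n)
        ≈⟨ +-cong (trans (*-congʳ (+-identityʳ 1#)) (*-identityˡ _)) (∑-≈0 D (λ p → zeroˡ _)) ⟩
      Σnat h 0 n + 0#
        ≈⟨ +-identityʳ _ ⟩
      Σnat h 0 n
        ≈⟨ Σnat-zero≈Σpos-zero n ⟩
      Σpos h 0 n ∎)
      where
      Σnat-zero≈Σpos-zero : ∀ n → Σnat h 0 n ≈ Σpos h 0 n
      Σnat-zero≈Σpos-zero zero    = refl
      Σnat-zero≈Σpos-zero (suc n) = refl
    Σpos≈∑binomial*Σnat {suc m} {suc D} (s≤s m≤D) n = begin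
      Σpos h (suc m) n
        ≈⟨ Σpos-suc h m n ⟩
      ∑[ i < n ] (h (suc i) * Σpos h m (n ∸ suc i))
        ≈⟨ ∑-cong n (λ i _ → *-congˡ (Σpos≈∑binomial*Σnat (m≤n⇒m≤1+n m≤D) (n ∸ suc i))) ⟩
      ∑[ i < n ] (h (suc i) * ∑[ p < suc (suc D) ] (b p * Σnat h p (n ∸ suc i)))
        ≈⟨ ∑-cong n (λ i _ → *-distribˡ-∑ (suc (suc D)) (h (suc i)) _) ⟩
      ∑[ i < n ] ∑[ p < suc (suc D) ] (h (suc i) * (b p * Σnat h p (n ∸ suc i)))
        ≈⟨ ∑-swap n (suc (suc D)) _ ⟩
      ∑[ p < suc (suc D) ] ∑[ i < n ] (h (suc i) * (b p * Σnat h p (n ∸ suc i)))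
        ≈⟨ ∑-cong (suc (suc D)) (λ p _ → pullOut p) ⟩
      ∑[ p < suc (suc D) ] (b p * (Σnat h (suc p) n + Σnat h p n))
        ≈⟨ ∑-pascal m≤D (λ p → Σnat h p n) ⟩
      ∑[ p < suc (suc D) ] (fromℕ (suc m C p) * Σnat h p n) ∎
      where
      b : ℕ → Carrier
      b p = fromℕ (m C p)
      pullOut : ∀ p → ∑[ i < n ] (h (suc i) * (b p * Σnat h p (n ∸ suc i))) ≈ b p * (Σnat h (suc p) n + Σnat h p n)
      pullOut p = begin
        ∑[ i < n ] (h (suc i) * (b p * Σnat h p (n ∸ suc i)))   ≈⟨ ∑-cong n (λ i _ → x∙yz≈y∙xz _ _ _) ⟩
        ∑[ i < n ] (b p * (h (suc i) * Σnat h p (n ∸ suc i)))   ≈⟨ *-distribˡ-∑ n (b p) _ ⟨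
        b p * ∑[ i < n ] (h (suc i) * Σnat h p (n ∸ suc i))     ≈⟨ *-congˡ (∑-Σnat-positiveFirst p n) ⟩
        b p * (Σnat h (suc p) n + Σnat h p n)                   ∎

    ∑Σpos≈∑binomial*Σnat : ∀ n → ∑[ m < suc n ] Σpos h m n ≈ ∑[ p < suc n ] (fromℕ (suc n C suc p) * Σnat h p n)
    ∑Σpos≈∑binomial*Σnat n = begin
      ∑[ m < suc n ] Σpos h m n
        ≈⟨ ∑-cong (suc n) (λ m m≤n → Σpos≈∑binomial*Σnat (≤-pred m≤n) n) ⟩
      ∑[ m < suc n ] ∑[ p < suc n ] (fromℕ (m C p) * Σnat h p n)
        ≈⟨ ∑-swap (suc n) (suc n) _ ⟩
      ∑[ p < suc n ] ∑[ m < suc n ] (fromℕ (m C p) * Σnat h p n)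
        ≈⟨ ∑-cong (suc n) (λ p _ → sym (*-distribʳ-∑ (suc n) (Σnat h p n) _)) ⟩
      ∑[ p < suc n ] (∑[ m < suc n ] fromℕ (m C p) * Σnat h p n)
        ≈⟨ ∑-cong (suc n) (λ p _ → *-congʳ (∑-hockey-stick (suc n) p)) ⟩
      ∑[ p < suc n ] (fromℕ (suc n C suc p) * Σnat h p n) ∎

    Σ𝒞≈Σ-binomial*natTuples : ∀ n →
      Σ𝒞 h (suc n) ≈ Σ (map (λ p → fromℕ (suc (suc n) C suc p) * Σnat h p (suc n)) (oneTo (suc n)))
    Σ𝒞≈Σ-binomial*natTuples n = begin
      Σ𝒞 h N
        ≈⟨ trans (Σ𝒞≈∑Σpos h N) (∑Σpos≈∑binomial*Σnat N) ⟩
      ∑[ p < suc N ] (binom p * Σnat h p N)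
        ≈⟨ ∑-suc N (λ p → binom p * Σnat h p N) ⟩
      binom 0 * 0# + ∑[ p < N ] (binom (suc p) * Σnat h (suc p) N)
        ≈⟨ trans (+-congʳ (zeroʳ _)) (+-identityˡ _) ⟩
      ∑[ p < N ] (binom (suc p) * Σnat h (suc p) N)
        ≈⟨ Σ-map-applyUpTo (λ p → binom p * Σnat h p N) suc N ⟨
      Σ (map (λ p → binom p * Σnat h p N) (oneTo N)) ∎
      where
      N : ℕ
      N = suc n
      binom : ℕ → Carrier
      binom p = fromℕ (suc N C suc p)

  negate : (ℕ → Carrier) → ℕ → Carrier
  negate f k = - f k

  -‿sgn* : ∀ p a → - (sgn p * a) ≈ sgn (suc p) * a
  -‿sgn* p a = trans (sym (-1*x≈-x _)) (sym (*-assoc _ _ _))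

  -x*[sgn*y] : ∀ a p b → - a * (sgn p * b) ≈ sgn (suc p) * (a * b)
  -x*[sgn*y] a p b = trans (*-congʳ (sym (-1*x≈-x a))) (interchange (- 1#) a (sgn p) b)

  prodOf-negate : ∀ f π → prodOf (negate f) π ≈ sgn (len π) * prodOf f π
  prodOf-negate f []      = sym (*-identityˡ 1#)
  prodOf-negate f (k ∷ π) = trans (*-congˡ (prodOf-negate f π)) (-x*[sgn*y] (f k) (len π) _)

  Σpos-negate : ∀ f p n → Σpos (negate f) p n ≈ sgn p * Σpos f p n
  Σpos-negate f zero zero    = sym (*-identityˡ _)
  Σpos-negate f zero (suc n) = sym (*-identityˡ _)
  Σpos-negate f (suc p) n = begin
    Σpos (negate f) (suc p) n
      ≈⟨ Σpos-suc (negate f) p n ⟩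
    ∑[ i < n ] (- f (suc i) * Σpos (negate f) p (n ∸ suc i))
      ≈⟨ ∑-cong n (λ i _ → *-congˡ (Σpos-negate f p _)) ⟩
    ∑[ i < n ] (- f (suc i) * (sgn p * Σpos f p (n ∸ suc i)))
      ≈⟨ ∑-cong n (λ i _ → -x*[sgn*y] _ p _) ⟩
    ∑[ i < n ] (sgn (suc p) * (f (suc i) * Σpos f p (n ∸ suc i)))
      ≈⟨ *-distribˡ-∑ n (sgn (suc p)) _ ⟨
    sgn (suc p) * ∑[ i < n ] (f (suc i) * Σpos f p (n ∸ suc i))
      ≈⟨ *-congˡ (Σpos-suc f p n) ⟨
    sgn (suc p) * Σpos f (suc p) n ∎

  Σnat-negate : ∀ f p n → Σnat (negate f) p n ≈ sgn p * Σnat f p n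
  Σnat-negate f zero zero    = sym (*-identityˡ _)
  Σnat-negate f zero (suc n) = sym (*-identityˡ _)
  Σnat-negate f (suc p) n = begin
    Σnat (negate f) (suc p) n
      ≈⟨ Σnat-suc (negate f) p n ⟩
    ∑[ i < suc n ] (- f i * Σnat (negate f) p (n ∸ i))
      ≈⟨ ∑-cong (suc n) (λ i _ → *-congˡ (Σnat-negate f p _)) ⟩
    ∑[ i < suc n ] (- f i * (sgn p * Σnat f p (n ∸ i)))
      ≈⟨ ∑-cong (suc n) (λ i _ → -x*[sgn*y] _ p _) ⟩
    ∑[ i < suc n ] (sgn (suc p) * (f i * Σnat f p (n ∸ i)))
      ≈⟨ *-distribˡ-∑ (suc n) (sgn (suc p)) _ ⟨
    sgn (suc p) * ∑[ i < suc n ] (f i * Σnat f p (n ∸ i))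
      ≈⟨ *-congˡ (Σnat-suc f p n) ⟨
    sgn (suc p) * Σnat f (suc p) n ∎

  module _ (g : ℕ → Carrier) where

    x-suc≈∑x*g : ∀ m → x g (suc m) ≈ ∑[ i < suc m ] (x g i * g (suc m ∸ i))
    x-suc≈∑x*g m = begin
      x g (suc m)
        ≈⟨ x≈Σ𝒞 g (suc m) ⟩
      Σ𝒞 g (suc m)
        ≈⟨ Σ𝒞-suc g m ⟩
      ∑[ i < suc m ] (g (suc i) * Σ𝒞 g (m ∸ i))
        ≈⟨ ∑-cong (suc m) (λ i _ → *-congˡ (sym (x≈Σ𝒞 g (m ∸ i)))) ⟩
      ∑[ i < suc m ] (g (suc i) * x g (m ∸ i))
        ≈⟨ ∑-reverse (suc m) (λ i → g (suc i) * x g (m ∸ i)) ⟩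
      ∑[ i < suc m ] (g (suc (m ∸ i)) * x g (m ∸ (m ∸ i)))
        ≈⟨ ∑-cong (suc m) (λ i i≤m → reindex (≤-pred i≤m)) ⟩
      ∑[ i < suc m ] (x g i * g (suc m ∸ i)) ∎
      where
      reindex : ∀ {i} → i ≤ m → g (suc (m ∸ i)) * x g (m ∸ (m ∸ i)) ≈ x g i * g (suc m ∸ i)
      reindex i≤m = trans (*-comm _ _) (*-cong (reflexive (≡.cong (x g) (m∸[m∸n]≡n i≤m)))
                                               (reflexive (≡.cong g (≡.sym (+-∸-assoc 1 i≤m)))))

    module _ (g₀≈-1 : g 0 ≈ - 1#) where

      ∑x*g≈0 : ∀ m → ∑[ i < suc (suc m) ] (x g i * g (suc m ∸ i)) ≈ 0#
      ∑x*g≈0 m = begin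
        ∑[ i < suc (suc m) ] (x g i * g (suc m ∸ i))
          ≈⟨ ∑-last (suc m) (λ i → x g i * g (suc m ∸ i)) ⟩
        ∑[ i < suc m ] (x g i * g (suc m ∸ i)) + x g (suc m) * g (m ∸ m)
          ≈⟨ +-cong (sym (x-suc≈∑x*g m)) (*-congˡ g[m∸m]≈-1) ⟩
        x g (suc m) + x g (suc m) * - 1#
          ≈⟨ +-congˡ (trans (*-comm _ _) (-1*x≈-x _)) ⟩
        x g (suc m) + - x g (suc m)
          ≈⟨ -‿inverseʳ _ ⟩
        0# ∎
        where
        g[m∸m]≈-1 : g (m ∸ m) ≈ - 1#
        g[m∸m]≈-1 = trans (reflexive (≡.cong g (n∸n≡0 m))) g₀≈-1

      Σ𝒞-negate-x≈-g : ∀ n → Σ𝒞 (negate (x g)) n ≈ - g n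
      Σ𝒞-negate-x≈-g = <-rec _ step
        where
        step : ∀ n → (∀ {k} → k < n → Σ𝒞 (negate (x g)) k ≈ - g k) → Σ𝒞 (negate (x g)) n ≈ - g n
        step zero    _  = trans (+-identityʳ 1#) (trans (sym (-‿involutive 1#)) (-‿cong (sym g₀≈-1)))
        step (suc m) IH = begin
          Σ𝒞 (negate (x g)) (suc m)
            ≈⟨ Σ𝒞-suc (negate (x g)) m ⟩
          ∑[ i < suc m ] (- x g (suc i) * Σ𝒞 (negate (x g)) (m ∸ i))
            ≈⟨ ∑-cong (suc m) (λ i _ → *-congˡ (IH (s≤s (m∸n≤m m i)))) ⟩
          ∑[ i < suc m ] (- x g (suc i) * - g (m ∸ i))
            ≈⟨ ∑-cong (suc m) (λ i _ → -x*-y≈x*y _ _) ⟩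
          ∑[ i < suc m ] (x g (suc i) * g (m ∸ i))
            ≈⟨ inverseʳ-unique _ _ (trans (sym (∑-suc (suc m) (λ i → x g i * g (suc m ∸ i)))) (∑x*g≈0 m)) ⟩
          - (1# * g (suc m))
            ≈⟨ -‿cong (*-identityˡ _) ⟩
          - g (suc m) ∎
          where
          -x*-y≈x*y : ∀ a b → - a * - b ≈ a * b
          -x*-y≈x*y a b = trans (sym (-‿distribʳ-* (- a) b)) (trans (-‿cong (sym (-‿distribˡ-* a b))) (-‿involutive _))

      g≈-Σ𝒞-negate-x : ∀ n → g n ≈ - Σ𝒞 (negate (x g)) n
      g≈-Σ𝒞-negate-x n = trans (sym (-‿involutive (g n))) (-‿cong (sym (Σ𝒞-negate-x≈-g n)))

      g≈Σ-signed-𝒞 : ∀ n → g n ≈ Σ (map (λ π → sgn (suc (len π)) * prodOf (x g) π) (𝒞 n))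
      g≈Σ-signed-𝒞 n = trans (g≈-Σ𝒞-negate-x n)
        (-‿Σ-map (λ π → trans (-‿cong (prodOf-negate (x g) π)) (-‿sgn* (len π) _)) (𝒞 n))

      g≈Σ-signed-posTuples : ∀ n →
        g (suc n) ≈ Σ (map (λ p → sgn (suc p) * Σpos (x g) p (suc n)) (oneTo (suc n)))
      g≈Σ-signed-posTuples n = trans (g≈-Σ𝒞-negate-x (suc n))
        (trans (-‿cong (Σ𝒞≈Σ-posTuples (negate (x g)) n))
               (-‿Σ-map (λ p → trans (-‿cong (Σpos-negate (x g) p (suc n))) (-‿sgn* p _)) (oneTo (suc n))))

      g≈Σ-signed-binomial*natTuples : ∀ n →
        g (suc n) ≈ Σ (map (λ p → sgn (suc p) * (fromℕ (suc (suc n) C suc p) * Σnat (x g) p (suc n))) (oneTo (suc n)))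
      g≈Σ-signed-binomial*natTuples n = trans (g≈-Σ𝒞-negate-x (suc n))
        (trans (-‿cong (Σ𝒞≈Σ-binomial*natTuples (negate (x g)) refl n))
               (-‿Σ-map (λ p → trans (-‿cong (trans (*-congˡ (Σnat-negate (x g) p (suc n))) (x∙yz≈y∙xz _ _ _)))
                                     (-‿sgn* p _))
                        (oneTo (suc n))))

theorem6 : ∀ {c ℓ : Level} (R : CommutativeRing c ℓ) (g : ℕ → CommutativeRing.Carrier R) →
  CommutativeRing._≈_ R (g 0) (CommutativeRing.-_ R (CommutativeRing.1# R)) →
  ∀ (n : ℕ) → 1 ≤ n →
    let open CommutativeRing R
        open PI R
    in (x g n ≈ Σ (map (prodOf g) (𝒞 n)))
     × (x g n ≈ Σ (map (λ p → Σ (map (prodOf g) (posTuples p n))) (oneTo n)))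
     × (x g n ≈ Σ (map (λ p → fromℕ (suc n C suc p) * Σ (map (prodOf g) (natTuples p n))) (oneTo n)))
     × (g n ≈ Σ (map (λ π → sgn (suc (len π)) * prodOf (x g) π) (𝒞 n)))
     × (g n ≈ Σ (map (λ p → sgn (suc p) * Σ (map (prodOf (x g)) (posTuples p n))) (oneTo n)))
     × (g n ≈ Σ (map (λ p → sgn (suc p) * (fromℕ (suc n C suc p) * Σ (map (prodOf (x g)) (natTuples p n)))) (oneTo n)))
theorem6 R g g₀≈-1 (suc n) _ =
    x≈Σ𝒞 R g (suc n)
  , trans (x≈Σ𝒞 R g (suc n)) (Σ𝒞≈Σ-posTuples R g n)
  , trans (x≈Σ𝒞 R g (suc n)) (Σ𝒞≈Σ-binomial*natTuples R g g₀≈-1 n)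
  , g≈Σ-signed-𝒞 R g g₀≈-1 (suc n)
  , g≈Σ-signed-posTuples R g g₀≈-1 n
  , g≈Σ-signed-binomial*natTuples R g g₀≈-1 n
  where open CommutativeRing R using (trans)
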